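{- Let $n,k\in\mathbb{N}$ with $n\ge 3$ and $k\ge 2$, and let $MC_n^k$ be the multilayered cycle. Then the strong vertex span and the direct vertex span of $MC_n^k$ satisfy $$\sigma^{\boxtimes}_V(MC_n^k)=\sigma^{\times}_V(MC_n^k)=\left\lfloor\frac{n}{2}\right\rfloor+1.$$
   Context: For $n\ge3$, $k\ge2$, the multilayered cycle $MC_n^k$ is the graph with vertex set $\{(i,j): i\in\mathbb{Z}_n,\ j\in\{1,\dots,k\}\}$ in which $(a,b)$ and $(c,d)$ are adjacent iff either $a=c$ and $|d-b|=1$, or $b=d$ and $|a-c|\in\{1,n-1\}$ (i.e. $a-c\equiv\pm1 \pmod n$). Write $\mathbb{N}_l=\{1,\dots,l\}$ and let $d$ denote the shortest-path distance in the graph. For a graph $G$ and $l\in\mathbb{N}$: an $l$-track is a surjective map $f:\mathbb{N}_l\to V(G)$ with $f(i)f(i+1)\in E(G)$ for all $i\in\mathbb{N}_{l-1}$; a lazy $l$-track is a surjective map $f:\mathbb{N}_l\to V(G)$ with $f(i)f(i+1)\in E(G)$ or $f(i)=f(i+1)$ for all $i\in\mathbb{N}_{l-1}$. For two maps $f,g:\mathbb{N}_l\to V(G)$ set $m_G(f,g)=\min\{d(f(i),g(i)): i\in\mathbb{N}_l\}$. The strong vertex span $\sigma^{\boxtimes}_V(G)$ is the maximum of $m_G(f,g)$ over all $l\in\mathbb{N}$ and all pairs $f,g$ of lazy $l$-tracks on $G$. The direct vertex span $\sigma^{\times}_V(G)$ is the maximum of $m_G(f,g)$ over all $l\in\mathbb{N}$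 and all pairs $f,g$ of $l$-tracks on $G$. -}

module Defs where

open import Data.Nat using (ℕ; zero; suc; _≤_)
open import Data.Fin using (Fin; toℕ)
open import Data.Product using (Σ; _×_; ∃; ∃-syntax; _,_)
open import Data.Sum using (_⊎_)
open import Relation.Binary.PropositionalEquality using (_≡_)

record Graph : Set₁ where
  field
    V   : Set
    Adj : V → V → Set
open Graph public

module _ (G : Graph) where

  data Walk : V G → V G → ℕ → Set where
    nil  : ∀ {u} → Walk u u 0
    cons : ∀ {u w v m} → Adj G u w → Walk w v m → Walk u v (suc m)

  Dist : V G → V G → ℕ → Set
  Dist u v m = Walk u v m × (∀ m′ → Walk u v m′ → m ≤ m′)

  -- maps N_l → V(G), with N_l = {1..l} represented by Fin l = {0..l-1}
  Surjective : ∀ {l} → (Fin l → V G) → Set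
  Surjective {l} f = ∀ v → ∃[ i ] f i ≡ v

  IsTrack : ∀ {l} → (Fin l → V G) → Set
  IsTrack {l} f = Surjective f ×
    (∀ (i j : Fin l) → toℕ j ≡ suc (toℕ i) → Adj G (f i) (f j))

  IsLazyTrack : ∀ {l} → (Fin l → V G) → Set
  IsLazyTrack {l} f = Surjective f ×
    (∀ (i j : Fin l) → toℕ j ≡ suc (toℕ i) → Adj G (f i) (f j) ⊎ f i ≡ f j)

  MinDist : ∀ {l} → (Fin l → V G) → (Fin l → V G) → ℕ → Set
  MinDist {l} f g m = (∃[ i ] Dist (f i) (g i) m) ×
    (∀ (i : Fin l) m′ → Dist (f i) (g i) m′ → m ≤ m′)

  IsMaxSpan : (∀ {l} → (Fin l → V G) → Set) → ℕ → Set
  IsMaxSpan P σ =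
    (Σ ℕ λ l → Σ (Fin l → V G) λ f → Σ (Fin l → V G) λ g →
        P f × P g × MinDist f g σ) ×
    (∀ l (f g : Fin l → V G) s → P f → P g → MinDist f g s → s ≤ σ)

  IsStrongVertexSpan : ℕ → Set
  IsStrongVertexSpan = IsMaxSpan IsLazyTrack

  IsDirectVertexSpan : ℕ → Set
  IsDirectVertexSpan = IsMaxSpan IsTrack

-- adjacency on the cycle Z_n (vertices 0..n-1): a - c ≡ ±1 (mod n)
CycAdj : (n : ℕ) → Fin n → Fin n → Set
CycAdj n a c =
  toℕ c ≡ suc (toℕ a) ⊎ toℕ a ≡ suc (toℕ c) ⊎
  (toℕ a ≡ 0 × suc (toℕ c) ≡ n) ⊎ (toℕ c ≡ 0 × suc (toℕ a) ≡ n)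

-- adjacency on the path of layers 1..k (represented as 0..k-1): |d - b| = 1
PathAdj : (k : ℕ) → Fin k → Fin k → Set
PathAdj k b d = toℕ d ≡ suc (toℕ b) ⊎ toℕ b ≡ suc (toℕ d)

MC : ℕ → ℕ → Graph
MC n k = record
  { V   = Fin n × Fin k
  ; Adj = λ { (a , b) (c , d) → (a ≡ c × PathAdj k b d) ⊎ (b ≡ d × CycAdj n a c) }
  }

-- In MC_n^k the distance from (a,b) to (c,d) is min(|a-c|, n-|a-c|) + |b-d|: walks of that
-- length exist, and no walk is shorter because this quantity drops by at most one along each edge.
-- Upper bound: along a lazy track the layer changes by at most one per step, and both tracks visit
-- layer 0, so by a discrete intermediate value argument there is a time at which the two tracks are in
-- equal or adjacent layers; there their distance is at most ⌊n/2⌋ + 1.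
-- Lower bound: let both tracks run around the cycle in lockstep, g half a turn ahead of f, while their
-- layers zigzag through the pairs (0,1), (1,0), (2,1), ..., (k-1,k-2), (k-2,k-1). The layers always
-- differ by one, so the distance is ⌊n/2⌋ + 1 throughout, and each track visits every vertex.
module Submission where

open import Defs
open import Data.Nat
  using (ℕ; zero; suc; _+_; _∸_; _≤_; _<_; z≤n; s≤s; z<s; s<s; ∣_-_∣; NonZero; _⊓_; ⌊_/2⌋; ⌈_/2⌉)
open import Data.Nat.DivMod
  using ( _%_; _/_; _mod_; m%n<n; m<n⇒m%n≡m; m≡m%n+[m/n]*n; [m+kn]%n≡m%n; [m+n]%n≡m%n; n%n≡0
        ; %-distribˡ-+; m≤n⇒[n∸m]%m≡n%m)
open import Data.Nat.Properties
open import Data.Fin using (Fin; toℕ; fromℕ<) renaming (zero to fzero; suc to fsuc)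
open import Data.Fin.Properties using (toℕ-fromℕ<; toℕ<n; toℕ-injective)
open import Data.Product using (Σ; _×_; ∃-syntax; _,_; proj₁; proj₂)
open import Data.Sum using (_⊎_; inj₁; inj₂)
open import Function using (_∘_)
open import Relation.Binary.PropositionalEquality
open import Relation.Nullary using (yes; no)

module _ {G : Graph} where

  infixr 5 _++_
  _++_ : ∀ {u v w m m′} → Walk G u v m → Walk G v w m′ → Walk G u w (m + m′)
  nil      ++ q = q
  cons e p ++ q = cons e (p ++ q)

  snoc : ∀ {u v w m} → Walk G u v m → Adj G v w → Walk G u w (suc m)
  snoc nil        e = cons e nil
  snoc (cons e p) f = cons e (snoc p f)

  reverse : (∀ {u w} → Adj G u w → Adj G w u) → ∀ {u v m} → Walk G u v m → Walk G v u m
  reverse sym nil        = nil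
  reverse sym (cons e p) = snoc (reverse sym p) (sym e)

  walk-along : (x : ℕ → V G) (j : ℕ) → (∀ t → t < j → Adj G (x t) (x (suc t))) → Walk G (x 0) (x j) j
  walk-along x zero    adj = nil
  walk-along x (suc j) adj = cons (adj 0 z<s) (walk-along (x ∘ suc) j (λ t t<j → adj (suc t) (s<s t<j)))

  walk-between : (x : ℕ → V G) (j : ℕ) → (∀ t → t < j → Adj G (x t) (x (suc t))) →
                 ∀ {u v} → x 0 ≡ u → x j ≡ v → Walk G u v j
  walk-between x j adj refl refl = walk-along x j adj

  vertexAt : ∀ {u v m} → Walk G u v m → Fin (suc m) → V G
  vertexAt {u = u} _  fzero    = u
  vertexAt (cons _ p) (fsuc i) = vertexAt p i

  vertexAt-adjacent : ∀ {u v m} (p : Walk G u v m) (i j : Fin (suc m)) →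
                      toℕ j ≡ suc (toℕ i) → Adj G (vertexAt p i) (vertexAt p j)
  vertexAt-adjacent (cons e p) fzero    (fsuc fzero)    _  = e
  vertexAt-adjacent (cons e p) (fsuc i) (fsuc j)        eq = vertexAt-adjacent p i j (suc-injective eq)
  vertexAt-adjacent (cons e p) fzero    (fsuc (fsuc j)) ()
  vertexAt-adjacent p          i        fzero           ()

  vertexAt-along : ∀ (x : ℕ → V G) j adj (i : Fin (suc j)) → vertexAt (walk-along x j adj) i ≡ x (toℕ i)
  vertexAt-along x j       adj fzero    = refl
  vertexAt-along x (suc j) adj (fsuc i) = vertexAt-along (x ∘ suc) j _ i

  _∈ᵂ_ : ∀ {u v m} → V G → Walk G u v m → Set
  x ∈ᵂ p = ∃[ i ] vertexAt p i ≡ x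

  ∈-cons : ∀ {x u w v m} {e : Adj G u w} {p : Walk G w v m} → x ∈ᵂ p → x ∈ᵂ cons e p
  ∈-cons (i , eq) = fsuc i , eq

  ∈-++ˡ : ∀ {x u v w m m′} (p : Walk G u v m) {q : Walk G v w m′} → x ∈ᵂ p → x ∈ᵂ (p ++ q)
  ∈-++ˡ nil        (fzero , eq)  = fzero , eq
  ∈-++ˡ (cons e p) (fzero , eq)  = fzero , eq
  ∈-++ˡ (cons e p) (fsuc i , eq) = ∈-cons (∈-++ˡ p (i , eq))

  ∈-++ʳ : ∀ {x u v w m m′} (p : Walk G u v m) {q : Walk G v w m′} → x ∈ᵂ q → x ∈ᵂ (p ++ q)
  ∈-++ʳ nil        x∈q = x∈q
  ∈-++ʳ (cons e p) x∈q = ∈-cons (∈-++ʳ p x∈q)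

  ∈-along : ∀ (x : ℕ → V G) j adj {t} → t ≤ j → x t ∈ᵂ walk-along x j adj
  ∈-along x j adj t≤j = fromℕ< (s≤s t≤j) , trans (vertexAt-along x j adj _) (cong x (toℕ-fromℕ< _))

  AllVertices : ∀ {u v m} → (V G → Set) → Walk G u v m → Set
  AllVertices P p = ∀ i → P (vertexAt p i)

  All-cons : ∀ {P : V G → Set} {u w v m} {e : Adj G u w} {p : Walk G w v m} →
             P u → AllVertices P p → AllVertices P (cons e p)
  All-cons Pu Pp fzero    = Pu
  All-cons Pu Pp (fsuc i) = Pp i

  All-++ : ∀ {P : V G → Set} {u v w m m′} (p : Walk G u v m) {q : Walk G v w m′} →
           AllVertices P p → AllVertices P q → AllVertices P (p ++ q)
  All-++     nil        Pp Pq = Pq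
  All-++ {P} (cons e p) Pp Pq = All-cons {P} (Pp fzero) (All-++ {P} p (Pp ∘ fsuc) Pq)

  All-along : ∀ {P : V G → Set} (x : ℕ → V G) j adj → (∀ t → t ≤ j → P (x t)) → AllVertices P (walk-along x j adj)
  All-along {P} x j adj Px i = subst P (sym (vertexAt-along x j adj i)) (Px (toℕ i) (≤-pred (toℕ<n i)))

module _ {G : Graph} where

  module _ (φ : V G → ℕ) {v : V G} (φ-target : φ v ≡ 0) (φ-step : ∀ {u w} → Adj G u w → φ u ≤ suc (φ w)) where

    potential≤length : ∀ {u m} → Walk G u v m → φ u ≤ m
    potential≤length nil        = ≤-reflexive φ-target
    potential≤length (cons e p) = ≤-trans (φ-step e) (s≤s (potential≤length p))

    potential-Dist : ∀ {u L} → Walk G u v L → L ≤ φ u → Dist G u v (φ u)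
    potential-Dist p L≤φ = subst (Walk G _ v) (≤-antisym L≤φ (potential≤length p)) p , λ _ → potential≤length

  Dist-unique : ∀ {u v L L′} → Dist G u v L → Dist G u v L′ → L ≡ L′
  Dist-unique (p , p-min) (q , q-min) = ≤-antisym (p-min _ q) (q-min _ p)

  track⇒lazy : ∀ {l} {f : Fin l → V G} → IsTrack G f → IsLazyTrack G f
  track⇒lazy (surj , adj) = surj , λ i j eq → inj₁ (adj i j eq)

  MinDist-constant : ∀ {l σ} {f g : Fin l → V G} → Fin l → (∀ i → Dist G (f i) (g i) σ) → MinDist G f g σ
  MinDist-constant i₀ dist = (i₀ , dist i₀) , λ i _ d → ≤-reflexive (Dist-unique (dist i) d)

  vertex-spans : ∀ {σ} →
    (Σ ℕ λ l → Σ (Fin l → V G) λ f → Σ (Fin l → V G) λ g → IsTrack G f × IsTrack G g × MinDist G f g σ) →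
    (∀ l (f g : Fin l → V G) s → IsLazyTrack G f → IsLazyTrack G g → MinDist G f g s → s ≤ σ) →
    IsStrongVertexSpan G σ × IsDirectVertexSpan G σ
  vertex-spans (l , f , g , f-track , g-track , min) bound =
    ((l , f , g , track⇒lazy f-track , track⇒lazy g-track , min) , bound) ,
    ((l , f , g , f-track , g-track , min) ,
     λ l f g s f-track g-track → bound l f g s (track⇒lazy f-track) (track⇒lazy g-track))

_×ᴳ_ : Graph → Graph → Graph
G ×ᴳ H = record
  { V   = V G × V H
  ; Adj = λ { (u , u′) (w , w′) → Adj G u w × Adj H u′ w′ }
  }

module _ {G H : Graph} {u v m} (p : Walk (G ×ᴳ H) u v m) where

  proj₁-track : Surjective G (proj₁ ∘ vertexAt p) → IsTrack G (proj₁ ∘ vertexAt p)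
  proj₁-track surj = surj , λ i j eq → proj₁ (vertexAt-adjacent p i j eq)

  proj₂-track : Surjective H (proj₂ ∘ vertexAt p) → IsTrack H (proj₂ ∘ vertexAt p)
  proj₂-track surj = surj , λ i j eq → proj₂ (vertexAt-adjacent p i j eq)

module _ {n : ℕ} .{{_ : NonZero n}} where

  toℕ-mod : ∀ t → toℕ (t mod n) ≡ t % n
  toℕ-mod t = toℕ-fromℕ< _

  toℕ-mod-< : ∀ {t} → t < n → toℕ (t mod n) ≡ t
  toℕ-mod-< t<n = trans (toℕ-mod _) (m<n⇒m%n≡m t<n)

  mod-toℕ : (i : Fin n) → toℕ i mod n ≡ i
  mod-toℕ i = toℕ-injective (toℕ-mod-< (toℕ<n i))

  mod-cong : ∀ s t → s % n ≡ t % n → s mod n ≡ t mod n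
  mod-cong _ _ eq = toℕ-injective (trans (toℕ-mod _) (trans eq (sym (toℕ-mod _))))

  [m+2n]%n≡m%n : ∀ m → (m + (n + n)) % n ≡ m % n
  [m+2n]%n≡m%n m = trans (cong (_% n) (sym (+-assoc m n n))) (trans ([m+n]%n≡m%n (m + n) n) ([m+n]%n≡m%n m n))

  [1+m]%n≡[1+m%n]%n : ∀ m → suc m % n ≡ suc (m % n) % n
  [1+m]%n≡[1+m%n]%n m = trans (cong (λ t → suc t % n) (m≡m%n+[m/n]*n m n)) ([m+kn]%n≡m%n (suc (m % n)) (m / n) n)

  mod-suc-adjacent : ∀ s → CycAdj n (s mod n) (suc s mod n)
  mod-suc-adjacent s with m≤n⇒m<n∨m≡n (m%n<n s n)
  ... | inj₁ r+1<n = inj₁ (begin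
    toℕ (suc s mod n)     ≡⟨ toℕ-mod (suc s) ⟩
    suc s % n             ≡⟨ [1+m]%n≡[1+m%n]%n s ⟩
    suc (s % n) % n       ≡⟨ m<n⇒m%n≡m r+1<n ⟩
    suc (s % n)           ≡⟨ cong suc (toℕ-mod s) ⟨
    suc (toℕ (s mod n))   ∎)
    where open ≡-Reasoning
  ... | inj₂ r+1≡n = inj₂ (inj₂ (inj₂ (wraps-to-0 , trans (cong suc (toℕ-mod s)) r+1≡n)))
    where
    wraps-to-0 : toℕ (suc s mod n) ≡ 0
    wraps-to-0 = trans (toℕ-mod (suc s)) (trans ([1+m]%n≡[1+m%n]%n s) (trans (cong (_% n) r+1≡n) (n%n≡0 n)))

-- A discrete intermediate value theorem

∣-∣≤1⇒≤suc : ∀ {a b} → ∣ a - b ∣ ≤ 1 → a ≤ suc b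
∣-∣≤1⇒≤suc {a} {b} d≤1 = ≤-trans (m≤∣m-n∣+n a b) (+-monoˡ-≤ b d≤1)

≤≤suc⇒∣-∣≤1 : ∀ {a b} → a ≤ b → b ≤ suc a → ∣ a - b ∣ ≤ 1
≤≤suc⇒∣-∣≤1 {a} {b} a≤b b≤1+a = ≤-trans (≤-reflexive (m≤n⇒∣m-n∣≡n∸m a≤b))
  (≤-trans (∸-monoˡ-≤ a b≤1+a) (≤-reflexive (m+n∸n≡m 1 a)))

UnitSteps : (ℕ → ℕ) → ℕ → Set
UnitSteps x L = ∀ t → t < L → ∣ x t - x (suc t) ∣ ≤ 1

module _ (x y : ℕ → ℕ) {L : ℕ} (x-steps : UnitSteps x L) (y-steps : UnitSteps y L) where

  crossing : ∀ d t → t + d ≤ L → x t ≤ y t → y (t + d) ≤ x (t + d) → ∃[ s ] s ≤ L × ∣ x s - y s ∣ ≤ 1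
  crossing zero t t≤L x≤y y≤x rewrite +-identityʳ t = t , t≤L , ≤≤suc⇒∣-∣≤1 x≤y (≤-trans y≤x (n≤1+n _))
  crossing (suc d) t t+d≤L x≤y y≤x with x (suc t) ≤? y (suc t)
  ... | yes x≤y′ =
    crossing d (suc t) (subst (_≤ L) (+-suc t d) t+d≤L) x≤y′ (subst (λ r → y r ≤ x r) (+-suc t d) y≤x)
  ... | no  x≰y′ = t , ≤-trans (m≤m+n t (suc d)) t+d≤L , ≤≤suc⇒∣-∣≤1 x≤y y≤1+x
    where
    t<L : t < L
    t<L = ≤-trans (s≤s (m≤m+n t d)) (subst (_≤ L) (+-suc t d) t+d≤L)
    y≤1+x : y t ≤ suc (x t)
    y≤1+x = begin
      y t             ≤⟨ ∣-∣≤1⇒≤suc (y-steps t t<L) ⟩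
      suc (y (suc t)) ≤⟨ ≰⇒> x≰y′ ⟩
      x (suc t)       ≤⟨ ∣-∣≤1⇒≤suc (subst (_≤ 1) (∣-∣-comm (x t) _) (x-steps t t<L)) ⟩
      suc (x t)       ∎
      where open ≤-Reasoning

  ordered-ivt : ∀ {t₀ t₁} → t₀ ≤ t₁ → t₁ ≤ L → x t₀ ≡ 0 → y t₁ ≡ 0 → ∃[ s ] s ≤ L × ∣ x s - y s ∣ ≤ 1
  ordered-ivt {t₀} {t₁} t₀≤t₁ t₁≤L x₀ y₁ =
    crossing (t₁ ∸ t₀) t₀ (subst (_≤ L) t₁≡ t₁≤L) (subst (_≤ y t₀) (sym x₀) z≤n)
      (subst (λ r → y r ≤ x r) t₁≡ (subst (_≤ x t₁) (sym y₁) z≤n))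
    where
    t₁≡ : t₁ ≡ t₀ + (t₁ ∸ t₀)
    t₁≡ = sym (m+[n∸m]≡n t₀≤t₁)

discrete-ivt : ∀ x y {L} → UnitSteps x L → UnitSteps y L → ∀ {t₀ t₁} → t₀ ≤ L → t₁ ≤ L →
               x t₀ ≡ 0 → y t₁ ≡ 0 → ∃[ s ] s ≤ L × ∣ x s - y s ∣ ≤ 1
discrete-ivt x y x-steps y-steps {t₀} {t₁} t₀≤L t₁≤L x₀ y₁ with ≤-total t₀ t₁
... | inj₁ t₀≤t₁ = ordered-ivt x y x-steps y-steps t₀≤t₁ t₁≤L x₀ y₁
... | inj₂ t₁≤t₀ with ordered-ivt y x y-steps x-steps t₁≤t₀ t₀≤L y₁ x₀
...   | s , s≤L , near = s , s≤L , subst (_≤ 1) (∣-∣-comm (y s) (x s)) near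

module _ {G : Graph} (h : V G → ℕ) (h-adj : ∀ {u w} → Adj G u w → ∣ h u - h w ∣ ≤ 1) where

  -- A track on Fin (suc l) is read as the sequence t ↦ f (t mod suc l), of which only t ≤ l is used.
  lazy-height-steps : ∀ {l} {f : Fin (suc l) → V G} → IsLazyTrack G f → UnitSteps (λ t → h (f (t mod suc l))) l
  lazy-height-steps {l} {f} (_ , step) t t<l with step (t mod suc l) (suc t mod suc l) consecutive
    where
    consecutive : toℕ (suc t mod suc l) ≡ suc (toℕ (t mod suc l))
    consecutive = trans (toℕ-mod-< (s≤s t<l)) (cong suc (sym (toℕ-mod-< (≤-trans t<l (n≤1+n l)))))
  ... | inj₁ adj = h-adj adj
  ... | inj₂ eq rewrite eq | ∣n-n∣≡0 (h (f (suc t mod suc l))) = z≤n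

  lazy-tracks-meet : ∀ {l} {f g : Fin l → V G} {v₀} → IsLazyTrack G f → IsLazyTrack G g → h v₀ ≡ 0 →
                     ∃[ i ] ∣ h (f i) - h (g i) ∣ ≤ 1
  lazy-tracks-meet {zero} {v₀ = v₀} (f-surj , _) _ _ with f-surj v₀
  ... | () , _
  lazy-tracks-meet {suc l} {f} {g} {v₀} f-lazy g-lazy h₀ with proj₁ f-lazy v₀ | proj₁ g-lazy v₀
  ... | i₀ , fi₀ | i₁ , gi₁ with discrete-ivt x y (lazy-height-steps f-lazy) (lazy-height-steps g-lazy)
                                (≤-pred (toℕ<n i₀)) (≤-pred (toℕ<n i₁)) (at f i₀ fi₀) (at g i₁ gi₁)
    where
    x y : ℕ → ℕ
    x t = h (f (t mod suc l))
    y t = h (g (t mod suc l))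
    at : ∀ (F : Fin (suc l) → V G) i → F i ≡ v₀ → h (F (toℕ i mod suc l)) ≡ 0
    at F i eq = trans (cong (h ∘ F) (mod-toℕ i)) (trans (cong h eq) h₀)
  ...   | s , _ , near = s mod suc l , near

-- Distance on the cycle

either-⊓ : ∀ {P : ℕ → Set} A B → P A → P B → ∃[ L ] P L × L ≤ A ⊓ B
either-⊓ A B pA pB with ⊓-sel A B
... | inj₁ eq = A , pA , ≤-reflexive (sym eq)
... | inj₂ eq = B , pB , ≤-reflexive (sym eq)

∣-∣-suc : ∀ x → ∣ x - suc x ∣ ≡ 1
∣-∣-suc zero    = refl
∣-∣-suc (suc x) = ∣-∣-suc x

∣-∣-unit-step : ∀ x y z → ∣ x - y ∣ ≡ 1 → ∣ x - z ∣ ≤ suc ∣ y - z ∣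
∣-∣-unit-step x y z eq = subst (λ d → ∣ x - z ∣ ≤ d + ∣ y - z ∣) eq (∣-∣-triangle x y z)

PathAdj⇒∣-∣≡1 : ∀ {j} {b d : Fin j} → PathAdj j b d → ∣ toℕ b - toℕ d ∣ ≡ 1
PathAdj⇒∣-∣≡1 {b = b} (inj₁ eq) rewrite eq = ∣-∣-suc (toℕ b)
PathAdj⇒∣-∣≡1 {d = d} (inj₂ eq) rewrite eq = trans (∣-∣-comm (suc (toℕ d)) (toℕ d)) (∣-∣-suc (toℕ d))

m+[o∸[m∸n]]≡n+o : ∀ {m n o} → n ≤ m → m ≤ o → m + (o ∸ (m ∸ n)) ≡ n + o
m+[o∸[m∸n]]≡n+o {m} {n} {o} n≤m m≤o = begin
  m + (o ∸ (m ∸ n))             ≡⟨ cong (_+ (o ∸ (m ∸ n))) (sym (m+[n∸m]≡n n≤m)) ⟩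
  n + (m ∸ n) + (o ∸ (m ∸ n))   ≡⟨ +-assoc n (m ∸ n) _ ⟩
  n + ((m ∸ n) + (o ∸ (m ∸ n))) ≡⟨ cong (n +_) (m+[n∸m]≡n (≤-trans (m∸n≤m m n) m≤o)) ⟩
  n + o                         ∎
  where open ≡-Reasoning

∸-≤-suc : ∀ n {A A′} → A′ ≤ suc A → n ∸ A ≤ suc (n ∸ A′)
∸-≤-suc zero    {A}                     _ rewrite 0∸n≡0 A = z≤n
∸-≤-suc (suc n) {A}     {zero}          _ = ≤-trans (m∸n≤m (suc n) A) (n≤1+n (suc n))
∸-≤-suc (suc n) {zero}  {suc zero}      _ = ≤-refl
∸-≤-suc (suc n) {zero}  {suc (suc _)}   (s≤s ())
∸-≤-suc (suc n) {suc A} {suc A′}        (s≤s A′≤1+A) = ∸-≤-suc n A′≤1+A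

-- cycleDist n ∣ a - c ∣ is the distance between the residues a and c on the cycle ℤₙ.
cycleDist : ℕ → ℕ → ℕ
cycleDist n A = A ⊓ (n ∸ A)

cycleDist-step : ∀ n {A A′} → A ≤ suc A′ → A′ ≤ suc A → cycleDist n A ≤ suc (cycleDist n A′)
cycleDist-step n A≤1+A′ A′≤1+A = ⊓-mono-≤ A≤1+A′ (∸-≤-suc n A′≤1+A)

cycleDist-unit-step : ∀ n x y z → ∣ x - y ∣ ≡ 1 → cycleDist n ∣ x - z ∣ ≤ suc (cycleDist n ∣ y - z ∣)
cycleDist-unit-step n x y z eq =
  cycleDist-step n (∣-∣-unit-step x y z eq) (∣-∣-unit-step y x z (trans (∣-∣-comm y x) eq))

cycleDist-wrap : ∀ n {A A′} → suc (A + A′) ≡ n → cycleDist n A ≤ suc (cycleDist n A′)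
cycleDist-wrap n {A} {A′} refl = begin
  A ⊓ (suc (A + A′) ∸ A)         ≡⟨ cong (λ B → A ⊓ (B ∸ A)) (sym (+-suc A A′)) ⟩
  A ⊓ (A + suc A′ ∸ A)           ≡⟨ cong (A ⊓_) (m+n∸m≡n A (suc A′)) ⟩
  A ⊓ suc A′                     ≡⟨ ⊓-comm A (suc A′) ⟩
  suc A′ ⊓ A                     ≤⟨ ⊓-monoʳ-≤ (suc A′) (≤-trans (n≤1+n A) (n≤1+n (suc A))) ⟩
  suc A′ ⊓ suc (suc A)           ≡⟨ cong (λ B → suc (A′ ⊓ B)) (sym (m+n∸n≡m (suc A) A′)) ⟩
  suc (A′ ⊓ (suc (A + A′) ∸ A′)) ∎
  where open ≤-Reasoning

cycleDist-complement : ∀ n {A} → A ≤ n → cycleDist n (n ∸ A) ≡ cycleDist n A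
cycleDist-complement n {A} A≤n = trans (cong ((n ∸ A) ⊓_) (m∸[m∸n]≡n A≤n)) (⊓-comm (n ∸ A) A)

cycleDist≤half : ∀ n {A} → A ≤ n → cycleDist n A ≤ ⌊ n /2⌋
cycleDist≤half n {A} A≤n = halve (cycleDist n A) n (begin
  cycleDist n A + cycleDist n A ≤⟨ +-mono-≤ (m⊓n≤m A (n ∸ A)) (m⊓n≤n A (n ∸ A)) ⟩
  A + (n ∸ A)                   ≡⟨ m+[n∸m]≡n A≤n ⟩
  n                             ∎)
  where
  open ≤-Reasoning
  halve : ∀ x y → x + x ≤ y → x ≤ ⌊ y /2⌋
  halve zero    y             _ = z≤n
  halve (suc x) (suc (suc y)) (s≤s x+1+x≤1+y) = s≤s (halve x y (≤-pred (subst (_≤ suc y) (+-suc x x) x+1+x≤1+y)))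
  halve (suc x) (suc zero)    (s≤s x+1+x≤0) with subst (_≤ 0) (+-suc x x) x+1+x≤0
  ... | ()

cycleDist-half : ∀ n → cycleDist n ⌊ n /2⌋ ≡ ⌊ n /2⌋
cycleDist-half n = m≤n⇒m⊓n≡m (m+n≤o⇒m≤o∸n ⌊ n /2⌋ (begin
  ⌊ n /2⌋ + ⌊ n /2⌋ ≤⟨ +-monoʳ-≤ ⌊ n /2⌋ (⌊n/2⌋≤⌈n/2⌉ n) ⟩
  ⌊ n /2⌋ + ⌈ n /2⌉ ≡⟨ ⌊n/2⌋+⌈n/2⌉≡n n ⟩
  n                 ∎))
  where open ≤-Reasoning

module _ {n : ℕ} .{{_ : NonZero n}} {m r : ℕ} (m<n : m < n) (r<n : r < n) where

  ∣r-[m+r]%n∣≡m⊎n∸m : ∣ r - (m + r) % n ∣ ≡ m ⊎ ∣ r - (m + r) % n ∣ ≡ n ∸ m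
  ∣r-[m+r]%n∣≡m⊎n∸m with m + r <? n
  ... | yes m+r<n = inj₁ (trans (cong ∣ r -_∣ (trans (m<n⇒m%n≡m m+r<n) (+-comm m r))) (∣m-m+n∣≡n r m))
  ... | no m+r≮n = inj₂ (begin
      ∣ r - (m + r) % n ∣     ≡⟨ cong₂ ∣_-_∣ r≡ [m+r]%n≡q ⟩
      ∣ (n ∸ m) + q - q ∣     ≡⟨ cong ∣_- q ∣ (+-comm (n ∸ m) q) ⟩
      ∣ q + (n ∸ m) - q ∣     ≡⟨ ∣-∣-comm (q + (n ∸ m)) q ⟩
      ∣ q - q + (n ∸ m) ∣     ≡⟨ ∣m-m+n∣≡n q (n ∸ m) ⟩
      n ∸ m                   ∎)
    where
    open ≡-Reasoning
    n≤m+r : n ≤ m + r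
    n≤m+r = ≮⇒≥ m+r≮n
    q : ℕ
    q = m + r ∸ n
    [m+r]%n≡q : (m + r) % n ≡ q
    [m+r]%n≡q = trans (sym (m≤n⇒[n∸m]%m≡n%m n≤m+r)) (m<n⇒m%n≡m (m<n+o⇒m∸n<o (m + r) n (+-mono-< m<n r<n)))
    r≡ : r ≡ (n ∸ m) + q
    r≡ = begin
      r             ≡⟨ m+n∸m≡n m r ⟨
      m + r ∸ m     ≡⟨ cong (_∸ m) (m+[n∸m]≡n n≤m+r) ⟨
      n + q ∸ m     ≡⟨ +-∸-comm q (<⇒≤ m<n) ⟩
      (n ∸ m) + q   ∎

cycleDist-offset : ∀ n .{{_ : NonZero n}} {m} s → m < n → cycleDist n ∣ s % n - (m + s) % n ∣ ≡ cycleDist n m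
cycleDist-offset n {m} s m<n = trans (cong (λ t → cycleDist n ∣ s % n - t ∣) [m+s]%n≡[m+r]%n) by-gap
  where
  [m+s]%n≡[m+r]%n : (m + s) % n ≡ (m + s % n) % n
  [m+s]%n≡[m+r]%n = trans (%-distribˡ-+ m s n) (cong (λ x → (x + s % n) % n) (m<n⇒m%n≡m m<n))
  by-gap : cycleDist n ∣ s % n - (m + s % n) % n ∣ ≡ cycleDist n m
  by-gap with ∣r-[m+r]%n∣≡m⊎n∸m m<n (m%n<n s n)
  ... | inj₁ eq = cong (cycleDist n) eq
  ... | inj₂ eq = trans (cong (cycleDist n) eq) (cycleDist-complement n (<⇒≤ m<n))

-- Distances in the multilayered cycle

module MultilayeredCycle (N K : ℕ) where

  n k : ℕ
  n = suc N
  k = suc K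

  Vertex : Set
  Vertex = Fin n × Fin k

  MC-sym : ∀ {u w} → Adj (MC n k) u w → Adj (MC n k) w u
  MC-sym (inj₁ (refl , inj₁ eq))               = inj₁ (refl , inj₂ eq)
  MC-sym (inj₁ (refl , inj₂ eq))               = inj₁ (refl , inj₁ eq)
  MC-sym (inj₂ (refl , inj₁ eq))               = inj₂ (refl , inj₂ (inj₁ eq))
  MC-sym (inj₂ (refl , inj₂ (inj₁ eq)))        = inj₂ (refl , inj₁ eq)
  MC-sym (inj₂ (refl , inj₂ (inj₂ (inj₁ eq)))) = inj₂ (refl , inj₂ (inj₂ (inj₂ eq)))
  MC-sym (inj₂ (refl , inj₂ (inj₂ (inj₂ eq)))) = inj₂ (refl , inj₂ (inj₂ (inj₁ eq)))

  layer-up : ∀ b → suc b < k → PathAdj k (b mod k) (suc b mod k)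
  layer-up b b+1<k = inj₁ (trans (toℕ-mod-< b+1<k) (cong suc (sym (toℕ-mod-< (<⇒≤ b+1<k)))))

  layer-down : ∀ b → suc b < k → PathAdj k (suc b mod k) (b mod k)
  layer-down b b+1<k = inj₂ (trans (toℕ-mod-< b+1<k) (cong suc (sym (toℕ-mod-< (<⇒≤ b+1<k)))))

  mcDist : Vertex → Vertex → ℕ
  mcDist (a , b) (c , d) = cycleDist n ∣ toℕ a - toℕ c ∣ + ∣ toℕ b - toℕ d ∣

  mcDist-self : ∀ v → mcDist v v ≡ 0
  mcDist-self (a , b) rewrite ∣n-n∣≡0 (toℕ a) | ∣n-n∣≡0 (toℕ b) = refl

  cycleDist-adjacent : ∀ {a a′} c → CycAdj n a a′ →
                       cycleDist n ∣ toℕ a - toℕ c ∣ ≤ suc (cycleDist n ∣ toℕ a′ - toℕ c ∣)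
  cycleDist-adjacent {a} {a′} c (inj₁ eq) =
    cycleDist-unit-step n (toℕ a) (toℕ a′) (toℕ c) (PathAdj⇒∣-∣≡1 {n} {a} {a′} (inj₁ eq))
  cycleDist-adjacent {a} {a′} c (inj₂ (inj₁ eq)) =
    cycleDist-unit-step n (toℕ a) (toℕ a′) (toℕ c) (PathAdj⇒∣-∣≡1 {n} {a} {a′} (inj₂ eq))
  cycleDist-adjacent {a′ = a′} c (inj₂ (inj₂ (inj₁ (a≡0 , a′+1≡n)))) rewrite a≡0 =
    cycleDist-wrap n (trans (cong suc (trans (cong (toℕ c +_) (m≤n⇒∣n-m∣≡n∸m c≤a′)) (m+[n∸m]≡n c≤a′))) a′+1≡n)
    where
    c≤a′ : toℕ c ≤ toℕ a′
    c≤a′ = ≤-pred (subst (toℕ c <_) (sym a′+1≡n) (toℕ<n c))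
  cycleDist-adjacent {a = a} c (inj₂ (inj₂ (inj₂ (a′≡0 , a+1≡n)))) rewrite a′≡0 =
    cycleDist-wrap n (trans (cong suc (trans (cong (_+ toℕ c) (m≤n⇒∣n-m∣≡n∸m c≤a)) (m∸n+n≡m c≤a))) a+1≡n)
    where
    c≤a : toℕ c ≤ toℕ a
    c≤a = ≤-pred (subst (toℕ c <_) (sym a+1≡n) (toℕ<n c))

  mcDist-adjacent : ∀ {u w} v → Adj (MC n k) u w → mcDist u v ≤ suc (mcDist w v)
  mcDist-adjacent {a , b} {_ , b′} (c , d) (inj₁ (refl , b~b′)) = begin
    cycleDist n ∣ toℕ a - toℕ c ∣ + ∣ toℕ b - toℕ d ∣        ≤⟨ +-monoʳ-≤ (cycleDist n ∣ toℕ a - toℕ c ∣)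
                                                               (∣-∣-unit-step (toℕ b) (toℕ b′) (toℕ d) (PathAdj⇒∣-∣≡1 b~b′)) ⟩
    cycleDist n ∣ toℕ a - toℕ c ∣ + suc ∣ toℕ b′ - toℕ d ∣   ≡⟨ +-suc _ _ ⟩
    suc (cycleDist n ∣ toℕ a - toℕ c ∣ + ∣ toℕ b′ - toℕ d ∣) ∎
    where open ≤-Reasoning
  mcDist-adjacent {_ , b} (c , d) (inj₂ (refl , a~a′)) = +-monoˡ-≤ ∣ toℕ b - toℕ d ∣ (cycleDist-adjacent c a~a′)

  cycle-walk : ∀ b (a c : Fin n) t → (toℕ a + t) % n ≡ toℕ c → Walk (MC n k) (a , b) (c , b) t
  cycle-walk b a c t eq = walk-between (λ s → (toℕ a + s) mod n , b) t (λ s _ → inj₂ (refl , step s))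
    (cong (_, b) (trans (cong (_mod n) (+-identityʳ (toℕ a))) (mod-toℕ a)))
    (cong (_, b) (trans (mod-cong (toℕ a + t) (toℕ c) (trans eq (sym (m<n⇒m%n≡m (toℕ<n c))))) (mod-toℕ c)))
    where
    step : ∀ s → CycAdj n ((toℕ a + s) mod n) ((toℕ a + suc s) mod n)
    step s rewrite +-suc (toℕ a) s = mod-suc-adjacent (toℕ a + s)

  short-cycle-walk-≤ : ∀ b (a c : Fin n) → toℕ a ≤ toℕ c →
                       ∃[ L ] Walk (MC n k) (a , b) (c , b) L × L ≤ cycleDist n ∣ toℕ a - toℕ c ∣
  short-cycle-walk-≤ b a c a≤c rewrite m≤n⇒∣m-n∣≡n∸m a≤c =
    either-⊓ (toℕ c ∸ toℕ a) (n ∸ (toℕ c ∸ toℕ a))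
      (cycle-walk b a c _ (trans (cong (_% n) (m+[n∸m]≡n a≤c)) (m<n⇒m%n≡m (toℕ<n c))))
      (reverse MC-sym (cycle-walk b c a _ (begin
        (toℕ c + (n ∸ (toℕ c ∸ toℕ a))) % n ≡⟨ cong (_% n) (m+[o∸[m∸n]]≡n+o a≤c (<⇒≤ (toℕ<n c))) ⟩
        (toℕ a + n) % n                     ≡⟨ [m+n]%n≡m%n (toℕ a) n ⟩
        toℕ a % n                           ≡⟨ m<n⇒m%n≡m (toℕ<n a) ⟩
        toℕ a                               ∎)))
    where open ≡-Reasoning

  short-cycle-walk : ∀ b (a c : Fin n) → ∃[ L ] Walk (MC n k) (a , b) (c , b) L × L ≤ cycleDist n ∣ toℕ a - toℕ c ∣
  short-cycle-walk b a c with ≤-total (toℕ a) (toℕ c)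
  ... | inj₁ a≤c = short-cycle-walk-≤ b a c a≤c
  ... | inj₂ c≤a with short-cycle-walk-≤ b c a c≤a
  ...   | L , p , L≤ = L , reverse MC-sym p , subst (λ A → L ≤ cycleDist n A) (∣-∣-comm (toℕ c) (toℕ a)) L≤

  layer-walk-≤ : ∀ a (b d : Fin k) → toℕ b ≤ toℕ d → Walk (MC n k) (a , b) (a , d) (toℕ d ∸ toℕ b)
  layer-walk-≤ a b d b≤d =
    walk-between (λ t → a , (toℕ b + t) mod k) (toℕ d ∸ toℕ b) (λ t t< → inj₁ (refl , step t t<))
    (cong (a ,_) (trans (cong (_mod k) (+-identityʳ (toℕ b))) (mod-toℕ b)))
    (cong (a ,_) (trans (cong (_mod k) (m+[n∸m]≡n b≤d)) (mod-toℕ d)))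
    where
    step : ∀ t → t < toℕ d ∸ toℕ b → PathAdj k ((toℕ b + t) mod k) ((toℕ b + suc t) mod k)
    step t t< rewrite +-suc (toℕ b) t =
      layer-up (toℕ b + t) (≤-trans (s≤s b+t<d) (toℕ<n d))
      where
      b+t<d : toℕ b + t < toℕ d
      b+t<d = ≤-trans (+-monoʳ-< (toℕ b) t<) (≤-reflexive (m+[n∸m]≡n b≤d))

  layer-walk : ∀ a (b d : Fin k) → Walk (MC n k) (a , b) (a , d) ∣ toℕ b - toℕ d ∣
  layer-walk a b d with ≤-total (toℕ b) (toℕ d)
  ... | inj₁ b≤d = subst (Walk (MC n k) _ _) (sym (m≤n⇒∣m-n∣≡n∸m b≤d)) (layer-walk-≤ a b d b≤d)
  ... | inj₂ d≤b = subst (Walk (MC n k) _ _) (sym (m≤n⇒∣n-m∣≡n∸m d≤b)) (reverse MC-sym (layer-walk-≤ a d b d≤b))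

  mc-Dist : ∀ u v → Dist (MC n k) u v (mcDist u v)
  mc-Dist (a , b) (c , d) with short-cycle-walk d a c
  ... | L , p , L≤ = potential-Dist (λ w → mcDist w (c , d)) (mcDist-self (c , d)) (mcDist-adjacent (c , d))
    (layer-walk a b d ++ p) (≤-trans (+-monoʳ-≤ ∣b-d∣ L≤) (≤-reflexive (+-comm ∣b-d∣ (cycleDist n ∣ toℕ a - toℕ c ∣))))
    where
    ∣b-d∣ : ℕ
    ∣b-d∣ = ∣ toℕ b - toℕ d ∣

  layer : Vertex → ℕ
  layer (_ , b) = toℕ b

  layer-adjacent : ∀ {u w} → Adj (MC n k) u w → ∣ layer u - layer w ∣ ≤ 1
  layer-adjacent     (inj₁ (_ , b~b′)) = ≤-reflexive (PathAdj⇒∣-∣≡1 b~b′)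
  layer-adjacent {u} (inj₂ (refl , _)) = subst (_≤ 1) (sym (∣n-n∣≡0 (layer u))) z≤n

  mcDist≤ : ∀ u v → ∣ layer u - layer v ∣ ≤ 1 → mcDist u v ≤ ⌊ n /2⌋ + 1
  mcDist≤ (a , _) (c , _) near = +-mono-≤ (cycleDist≤half n ∣a-c∣≤n) near
    where
    ∣a-c∣≤n : ∣ toℕ a - toℕ c ∣ ≤ n
    ∣a-c∣≤n = ≤-trans (∣m-n∣≤m⊔n (toℕ a) (toℕ c)) (⊔-lub (<⇒≤ (toℕ<n a)) (<⇒≤ (toℕ<n c)))

  lazy-span≤ : ∀ l (f g : Fin l → Vertex) s → IsLazyTrack (MC n k) f → IsLazyTrack (MC n k) g →
               MinDist (MC n k) f g s → s ≤ ⌊ n /2⌋ + 1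
  lazy-span≤ l f g s f-lazy g-lazy (_ , s-min)
    with lazy-tracks-meet layer (λ {u} {w} → layer-adjacent {u} {w}) {v₀ = fzero , fzero} f-lazy g-lazy refl
  ... | i , near = ≤-trans (s-min i _ (mc-Dist (f i) (g i))) (mcDist≤ (f i) (g i) near)

-- Two tracks at distance ⌊n/2⌋ + 1

module Tour (N K : ℕ) where
  open MultilayeredCycle N (suc K)

  m : ℕ
  m = ⌊ n /2⌋

  Pairs : Graph
  Pairs = MC n k ×ᴳ MC n k

  -- f in column s of layer b, and g half a turn ahead in layer d.
  pos : ℕ → ℕ → ℕ → V Pairs
  pos s b d = (s mod n , b mod k) , ((m + s) mod n , d mod k)

  lap-step : ∀ b d s → Adj Pairs (pos s b d) (pos (suc s) b d)
  lap-step b d s = inj₂ (refl , mod-suc-adjacent s) , inj₂ (refl , shifted)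
    where
    shifted : CycAdj n ((m + s) mod n) ((m + suc s) mod n)
    shifted rewrite +-suc m s = mod-suc-adjacent (m + s)

  -- Twice around the cycle, so that g as well passes every column (see g-surjective).
  lap : ∀ b d → Walk Pairs (pos 0 b d) (pos (n + n) b d) (n + n)
  lap b d = walk-along (λ s → pos s b d) (n + n) (λ s _ → lap-step b d s)

  switch : ∀ b b′ d d′ → PathAdj k (b mod k) (b′ mod k) → PathAdj k (d mod k) (d′ mod k) →
           Adj Pairs (pos (n + n) b d) (pos 0 b′ d′)
  switch _ _ _ _ b~b′ d~d′ =
    inj₁ (mod-cong (n + n) 0 ([m+2n]%n≡m%n {n} 0) , b~b′) ,
    inj₁ (mod-cong (m + (n + n)) (m + 0) (trans ([m+2n]%n≡m%n {n} m) (cong (_% n) (sym (+-identityʳ m)))) , d~d′)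

  stairs-length : ℕ → ℕ
  stairs-length zero    = n + n
  stairs-length (suc j) = stairs-length j + suc (n + n)

  stairs : ∀ j → j ≤ K → Walk Pairs (pos 0 1 0) (pos (n + n) (suc j) j) (stairs-length j)
  stairs zero    _   = lap 1 0
  stairs (suc j) j<K = stairs j (<⇒≤ j<K) ++
    cons (switch (suc j) (suc (suc j)) j (suc j) (layer-up (suc j) (s≤s (s≤s j<K))) (layer-up j (s≤s (s≤s (<⇒≤ j<K)))))
         (lap (suc (suc j)) (suc j))

  tour-length : ℕ
  tour-length = n + n + suc (stairs-length K + suc (n + n))

  tour : Walk Pairs (pos 0 0 1) (pos (n + n) K (suc K)) tour-length
  tour = lap 0 1 ++ cons (switch 0 1 1 0 (layer-up 0 (s≤s (s≤s z≤n))) (layer-down 0 (s≤s (s≤s z≤n))))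
           (stairs K ≤-refl ++ cons (switch (suc K) K K (suc K) (layer-down K ≤-refl) (layer-up K ≤-refl)) (lap K (suc K)))

  ∈-lap : ∀ b d {s} → s ≤ n + n → pos s b d ∈ᵂ lap b d
  ∈-lap b d = ∈-along (λ s → pos s b d) (n + n) (λ s _ → lap-step b d s)

  ∈-stairs : ∀ j j≤K {i s} → i ≤ j → s ≤ n + n → pos s (suc i) i ∈ᵂ stairs j j≤K
  ∈-stairs zero    _   z≤n s≤ = ∈-lap 1 0 s≤
  ∈-stairs (suc j) j<K i≤ s≤ with m≤n⇒m<n∨m≡n i≤
  ... | inj₁ i<1+j = ∈-++ˡ (stairs j _) (∈-stairs j _ (≤-pred i<1+j) s≤)
  ... | inj₂ refl  = ∈-++ʳ (stairs j _) (∈-cons (∈-lap (suc (suc j)) (suc j) s≤))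

  ∈-tour-stairs : ∀ {i s} → i ≤ K → s ≤ n + n → pos s (suc i) i ∈ᵂ tour
  ∈-tour-stairs i≤K s≤ = ∈-++ʳ (lap 0 1) (∈-cons (∈-++ˡ (stairs K ≤-refl) (∈-stairs K ≤-refl i≤K s≤)))

  f-layers : ∀ b → b < k → ∃[ d ] ∀ {s} → s ≤ n + n → pos s b d ∈ᵂ tour
  f-layers zero    _        = 1 , ∈-++ˡ (lap 0 1) ∘ ∈-lap 0 1
  f-layers (suc i) (s≤s i<) = i , ∈-tour-stairs (≤-pred i<)

  g-layers : ∀ d → d < k → ∃[ b ] ∀ {s} → s ≤ n + n → pos s b d ∈ᵂ tour
  g-layers d (s≤s d≤) with m≤n⇒m<n∨m≡n d≤
  ... | inj₁ d<1+K = suc d , ∈-tour-stairs (≤-pred d<1+K)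
  ... | inj₂ refl  = K , λ s≤ → ∈-++ʳ (lap 0 1) (∈-cons (∈-++ʳ (stairs K ≤-refl) (∈-cons (∈-lap K (suc K) s≤))))

  f-surjective : Surjective (MC n k) (proj₁ ∘ vertexAt tour)
  f-surjective (a , c) with f-layers (toℕ c) (toℕ<n c)
  ... | d , visits with visits (≤-trans (<⇒≤ (toℕ<n a)) (m≤m+n n n))
  ...   | i , eq = i , trans (cong proj₁ eq) (cong₂ _,_ (mod-toℕ a) (mod-toℕ c))

  g-surjective : Surjective (MC n k) (proj₂ ∘ vertexAt tour)
  g-surjective (a , c) with g-layers (toℕ c) (toℕ<n c)
  ... | b , visits with visits (+-mono-≤ (m∸n≤m n m) (<⇒≤ (toℕ<n a)))
  ...   | i , eq = i , trans (cong proj₂ eq) (cong₂ _,_ rotated (mod-toℕ c))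
    where
    rotated : (m + ((n ∸ m) + toℕ a)) mod n ≡ a
    rotated = trans (mod-cong (m + ((n ∸ m) + toℕ a)) (toℕ a) (begin
      (m + ((n ∸ m) + toℕ a)) % n ≡⟨ cong (_% n) (+-assoc m (n ∸ m) (toℕ a)) ⟨
      (m + (n ∸ m) + toℕ a) % n   ≡⟨ cong (λ x → (x + toℕ a) % n) (m+[n∸m]≡n (⌊n/2⌋≤n n)) ⟩
      (n + toℕ a) % n             ≡⟨ cong (_% n) (+-comm n (toℕ a)) ⟩
      (toℕ a + n) % n             ≡⟨ [m+n]%n≡m%n (toℕ a) n ⟩
      toℕ a % n                   ∎)) (mod-toℕ a)
      where open ≡-Reasoning

  Antipodal : V Pairs → Set
  Antipodal (u , v) = Dist (MC n k) u v (m + 1)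

  pos-antipodal : ∀ s b d → PathAdj k (b mod k) (d mod k) → Antipodal (pos s b d)
  pos-antipodal s b d b~d = subst (Dist (MC n k) _ _) (cong₂ _+_ cycle-part (PathAdj⇒∣-∣≡1 b~d)) (mc-Dist _ _)
    where
    open ≡-Reasoning
    cycle-part : cycleDist n ∣ toℕ (s mod n) - toℕ ((m + s) mod n) ∣ ≡ m
    cycle-part = begin
      cycleDist n ∣ toℕ (s mod n) - toℕ ((m + s) mod n) ∣
        ≡⟨ cong₂ (λ x y → cycleDist n ∣ x - y ∣) (toℕ-mod s) (toℕ-mod (m + s)) ⟩
      cycleDist n ∣ s % n - (m + s) % n ∣                 ≡⟨ cycleDist-offset n s (⌊n/2⌋<n N) ⟩
      cycleDist n m                                       ≡⟨ cycleDist-half n ⟩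
      m                                                   ∎

  lap-antipodal : ∀ b d → PathAdj k (b mod k) (d mod k) → AllVertices Antipodal (lap b d)
  lap-antipodal b d b~d =
    All-along {P = Antipodal} (λ s → pos s b d) (n + n) (λ s _ → lap-step b d s) (λ s _ → pos-antipodal s b d b~d)

  stairs-antipodal : ∀ j j≤K → AllVertices Antipodal (stairs j j≤K)
  stairs-antipodal zero    _   = lap-antipodal 1 0 (layer-down 0 (s≤s (s≤s z≤n)))
  stairs-antipodal (suc j) j<K = All-++ {P = Antipodal} (stairs j _) (stairs-antipodal j _)
    (All-cons {P = Antipodal} (pos-antipodal (n + n) (suc j) j (layer-down j (s≤s (s≤s (<⇒≤ j<K)))))
      (lap-antipodal (suc (suc j)) (suc j) (layer-down (suc j) (s≤s (s≤s j<K)))))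

  tour-antipodal : AllVertices Antipodal tour
  tour-antipodal = All-++ {P = Antipodal} (lap 0 1) (lap-antipodal 0 1 (layer-up 0 (s≤s (s≤s z≤n))))
    (All-cons {P = Antipodal} (pos-antipodal (n + n) 0 1 (layer-up 0 (s≤s (s≤s z≤n))))
      (All-++ {P = Antipodal} (stairs K ≤-refl) (stairs-antipodal K ≤-refl)
        (All-cons {P = Antipodal} (pos-antipodal (n + n) (suc K) K (layer-down K ≤-refl))
          (lap-antipodal K (suc K) (layer-up K ≤-refl)))))

  optimal-tracks : Σ ℕ λ l → Σ (Fin l → Vertex) λ f → Σ (Fin l → Vertex) λ g →
                   IsTrack (MC n k) f × IsTrack (MC n k) g × MinDist (MC n k) f g (⌊ n /2⌋ + 1)
  optimal-tracks = suc tour-length , proj₁ ∘ vertexAt tour , proj₂ ∘ vertexAt tour ,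
    proj₁-track tour f-surjective , proj₂-track tour g-surjective , MinDist-constant fzero tour-antipodal

theorem2 : (n k : ℕ) → 3 ≤ n → 2 ≤ k →
    IsStrongVertexSpan (MC n k) (⌊ n /2⌋ + 1) × IsDirectVertexSpan (MC n k) (⌊ n /2⌋ + 1)
theorem2 (suc N) (suc (suc K)) _ _      = vertex-spans (Tour.optimal-tracks N K) (MultilayeredCycle.lazy-span≤ N (suc K))
theorem2 (suc N) (suc zero)    _ (s≤s ())
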